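{- Let $\Lambda$ be a symplectic lattice with an orthogonal decomposition $\Lambda=U_1\oplus U_2\oplus\Lambda''$, where $U_1,U_2$ are copies of $U$, and put $\Lambda'=U_2\oplus\Lambda''$ (so $\Lambda=U_1\oplus\Lambda'$). Then for every $v\in\Lambda$ there exists $\gamma\in\Gamma_\Lambda$ with $\gamma(v)\in\Lambda'$.
   Context: A symplectic lattice is a free $\mathbb{Z}$-module $\Lambda$ of finite rank with a nondegenerate alternating bilinear form $(\cdot,\cdot)\colon\Lambda\times\Lambda\to\mathbb{Z}$. $U$ is the rank-2 lattice with Gram matrix $\begin{pmatrix}0&1\\-1&0\end{pmatrix}$. $\Lambda^\vee=\{v\in\Lambda\otimes\mathbb{Q}\mid (v,\Lambda)\subset\mathbb{Z}\}$, $D_\Lambda=\Lambda^\vee/\Lambda$. $\Gamma_\Lambda$ is the kernel of the natural map $\mathrm{Sp}(\Lambda)\to\mathrm{Sp}(D_\Lambda)$, where $\mathrm{Sp}$ denotes the group of isometries. -}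

module Defs where

open import Data.Nat using (ℕ; zero; suc)
open import Data.Fin using (Fin; zero; suc)
open import Data.Integer using (ℤ; +_; -_; _+_; _*_; _-_)
open import Data.Integer.Divisibility using (_∣_)
open import Data.Product using (Σ; _×_; _,_)
open import Relation.Binary.PropositionalEquality using (_≡_; _≢_)

Vec : ℕ → Set
Vec n = Fin n → ℤ

sumFin : ∀ {n} → (Fin n → ℤ) → ℤ
sumFin {zero}  f = + 0
sumFin {suc n} f = f zero + sumFin (λ i → f (suc i))

Mat : ℕ → Set
Mat n = Fin n → Fin n → ℤ

apply : ∀ {n} → Mat n → Vec n → Vec n
apply M v i = sumFin (λ j → M i j * v j)

form : ∀ {n} → Mat n → Vec n → Vec n → ℤ
form B v w = sumFin (λ i → sumFin (λ j → v i * B i j * w j))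

IsSymplectic : ∀ {n} → Mat n → Set
IsSymplectic {n} B =
  ((v : Vec n) → form B v v ≡ + 0) ×
  ((v : Vec n) → ((w : Vec n) → form B v w ≡ + 0) → (i : Fin n) → v i ≡ + 0)

-- Gram matrix of U₁ ⊕ U₂ ⊕ Λ'' on ℤ^(4+m): coordinates 0,1 span U₁ (e₁,f₁ with (e₁,f₁)=1),
-- coordinates 2,3 span U₂, the remaining m coordinates carry Λ'' with Gram matrix B''.
blockGram : ∀ {m} → Mat m → Mat (4 Data.Nat.+ m)
blockGram B zero (suc zero) = + 1
blockGram B (suc zero) zero = - (+ 1)
blockGram B (suc (suc zero)) (suc (suc (suc zero))) = + 1
blockGram B (suc (suc (suc zero))) (suc (suc zero)) = - (+ 1)
blockGram B (suc (suc (suc (suc i)))) (suc (suc (suc (suc j)))) = B i j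
blockGram B _ _ = + 0

InSp : ∀ {n} → Mat n → Mat n → Set
InSp {n} G M =
  Σ (Mat n) (λ N → ((v : Vec n) (i : Fin n) → apply M (apply N v) i ≡ v i) ×
                   ((v : Vec n) (i : Fin n) → apply N (apply M v) i ≡ v i)) ×
  ((v w : Vec n) → form G (apply M v) (apply M w) ≡ form G v w)

-- γ acts trivially on D_Λ = Λ^∨/Λ.  Every element of Λ ⊗ ℚ is x/d with x ∈ Λ, d ≥ 1;
-- x/d ∈ Λ^∨ iff d ∣ (x,w) for all w ∈ Λ, and γ(x/d) - x/d ∈ Λ iff d ∣ (γx - x)ᵢ for all i.
ActsTriviallyOnDisc : ∀ {n} → Mat n → Mat n → Set
ActsTriviallyOnDisc {n} G M =
  (d : ℕ) → d ≢ 0 → (x : Vec n) → ((w : Vec n) → (+ d) ∣ form G x w) →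
  (i : Fin n) → (+ d) ∣ (apply M x i - x i)

InΓ : ∀ {n} → Mat n → Mat n → Set
InΓ G M = InSp G M × ActsTriviallyOnDisc G M

{-# OPTIONS --safe #-}
module Submission where

-- Γ_Λ contains every transvection x ↦ x + k (x,u) u: it is an isometry because the form
-- is alternating, and it moves x by a multiple of (x,u), which d divides whenever
-- x/d ∈ Λ^∨.  On the coordinates (a,b,c,d) of v along e₁, f₁, e₂, f₂ the transvections
-- along these basis vectors act as the elementary shears of U₁ and U₂, and on vectors with
-- a = d = 0 the products τ[f₁+f₂] τ[f₂] and τ[e₁+e₂] τ[e₁] act as shears between b and c.
-- Three runs of the Euclidean algorithm, on (a,b), (d,c) and (b,c), then clear a, d and b.

open import Defs
open import Data.Fin using (Fin; zero; suc; #_; _↑ˡ_; _↑ʳ_)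
open import Data.Fin.Properties using (splitAt-↑ˡ)
open import Data.Integer using (ℤ; +_; -_; _+_; _*_; _-_; ∣_∣; NonZero; ≢-nonZero)
open import Data.Integer.DivMod using (_/_; _%_; a≡a%n+[a/n]*n; n%d<d)
open import Data.Integer.Divisibility using (_∣_)
import Data.Integer.Divisibility.Signed as Signed
import Data.Integer.Properties as ℤ
open import Algebra.Properties.AbelianGroup ℤ.+-0-abelianGroup using (inverseˡ-unique)
open import Data.Integer.Tactic.RingSolver using (solve-∀)
open import Data.Nat as ℕ using (ℕ; zero; suc)
open import Data.Nat.Induction using (<-wellFounded)
open import Data.Product using (Σ; _×_; _,_; proj₁; proj₂)
open import Data.Sum using ([_,_])
open import Data.Vec.Functional using (_∷_; []; _++_; replicate; take; drop)
open import Function using (_∘_; _on_)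
open import Induction.WellFounded using (Acc; acc)
open import Relation.Binary.Definitions using (Transitive)
open import Relation.Binary.PropositionalEquality
  using (_≡_; _≢_; _≗_; refl; sym; trans; cong; cong₂; subst; module ≡-Reasoning)
open import Relation.Nullary using (yes; no)

sumFin-cong : ∀ {n} {f g : Fin n → ℤ} → f ≗ g → sumFin f ≡ sumFin g
sumFin-cong {zero}  f≗g = refl
sumFin-cong {suc n} f≗g = cong₂ _+_ (f≗g zero) (sumFin-cong (f≗g ∘ suc))

sumFin-zero : ∀ {n} {f : Fin n → ℤ} → (∀ i → f i ≡ + 0) → sumFin f ≡ + 0
sumFin-zero {zero}  f≡0 = refl
sumFin-zero {suc n} f≡0 = cong₂ _+_ (f≡0 zero) (sumFin-zero (f≡0 ∘ suc))

sumFin-distrib-+ : ∀ {n} (f g : Fin n → ℤ) → sumFin (λ i → f i + g i) ≡ sumFin f + sumFin g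
sumFin-distrib-+ {zero}  f g = refl
sumFin-distrib-+ {suc n} f g = trans
  (cong (_+_ (f zero + g zero)) (sumFin-distrib-+ (f ∘ suc) (g ∘ suc)))
  (interchange (f zero) (g zero) _ _)
  where
  interchange : ∀ a b c d → a + b + (c + d) ≡ a + c + (b + d)
  interchange = solve-∀

*-distribˡ-sumFin : ∀ {n} c (f : Fin n → ℤ) → c * sumFin f ≡ sumFin (λ i → c * f i)
*-distribˡ-sumFin {zero}  c f = ℤ.*-zeroʳ c
*-distribˡ-sumFin {suc n} c f = trans
  (ℤ.*-distribˡ-+ c (f zero) _)
  (cong (_+_ (c * f zero)) (*-distribˡ-sumFin c (f ∘ suc)))

sumFin-comm : ∀ {m n} (f : Fin m → Fin n → ℤ) →
  sumFin (λ i → sumFin (f i)) ≡ sumFin (λ j → sumFin (λ i → f i j))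
sumFin-comm {zero} {n} f = sym (sumFin-zero {n} {λ _ → + 0} (λ _ → refl))
sumFin-comm {suc m} f = trans
  (cong (_+_ (sumFin (f zero))) (sumFin-comm (f ∘ suc)))
  (sym (sumFin-distrib-+ (f zero) (λ j → sumFin (λ i → f (suc i) j))))

δ : ∀ {n} → Fin n → Fin n → ℤ
δ zero    zero    = + 1
δ zero    (suc j) = + 0
δ (suc i) zero    = + 0
δ (suc i) (suc j) = δ i j

sumFin-δ : ∀ {n} (i : Fin n) (x : Vec n) → sumFin (λ j → δ i j * x j) ≡ x i
sumFin-δ zero    x = trans
  (cong₂ _+_ (ℤ.*-identityˡ (x zero)) (sumFin-zero {f = λ j → + 0 * x (suc j)} (λ _ → refl)))
  (ℤ.+-identityʳ (x zero))
sumFin-δ (suc i) x = trans (ℤ.+-identityˡ _) (sumFin-δ i (x ∘ suc))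

dot : ∀ {n} → Vec n → Vec n → ℤ
dot x y = sumFin (λ i → x i * y i)

dot-comm : ∀ {n} (x y : Vec n) → dot x y ≡ dot y x
dot-comm x y = sumFin-cong (λ i → ℤ.*-comm (x i) (y i))

dot-linearʳ : ∀ {n} (w x u : Vec n) c →
  dot w (λ i → x i + c * u i) ≡ dot w x + c * dot w u
dot-linearʳ w x u c = begin
  dot w (λ i → x i + c * u i)                ≡⟨ sumFin-cong (λ i → distrib (w i) (x i) c (u i)) ⟩
  sumFin (λ i → w i * x i + c * (w i * u i)) ≡⟨ sumFin-distrib-+ (λ i → w i * x i) (λ i → c * (w i * u i)) ⟩
  dot w x + sumFin (λ i → c * (w i * u i))   ≡⟨ cong (_+_ (dot w x)) (*-distribˡ-sumFin c (λ i → w i * u i)) ⟨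
  dot w x + c * dot w u                      ∎
  where
  open ≡-Reasoning
  distrib : ∀ a b c d → a * (b + c * d) ≡ a * b + c * (a * d)
  distrib = solve-∀

dot-linearˡ : ∀ {n} (x u w : Vec n) c →
  dot (λ i → x i + c * u i) w ≡ dot x w + c * dot u w
dot-linearˡ x u w c = trans (dot-comm (λ i → x i + c * u i) w)
  (trans (dot-linearʳ w x u c) (cong₂ (λ a b → a + c * b) (dot-comm w x) (dot-comm w u)))

dot-zeroʳ : ∀ {n} (x : Vec n) → dot x (λ _ → + 0) ≡ + 0
dot-zeroʳ x = sumFin-zero (λ i → ℤ.*-zeroʳ (x i))

apply-cong : ∀ {n} (M : Mat n) {x y : Vec n} → x ≗ y → apply M x ≗ apply M y
apply-cong M x≗y i = sumFin-cong (λ j → cong (M i j *_) (x≗y j))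

mul : ∀ {n} → Mat n → Mat n → Mat n
mul M N i j = sumFin (λ k → M i k * N k j)

apply-mul : ∀ {n} (M N : Mat n) (x : Vec n) → apply (mul M N) x ≗ apply M (apply N x)
apply-mul M N x i = begin
  sumFin (λ j → sumFin (λ k → M i k * N k j) * x j)
    ≡⟨ sumFin-cong (λ j → ℤ.*-comm _ (x j)) ⟩
  sumFin (λ j → x j * sumFin (λ k → M i k * N k j))
    ≡⟨ sumFin-cong (λ j → *-distribˡ-sumFin (x j) (λ k → M i k * N k j)) ⟩
  sumFin (λ j → sumFin (λ k → x j * (M i k * N k j)))
    ≡⟨ sumFin-comm (λ j k → x j * (M i k * N k j)) ⟩
  sumFin (λ k → sumFin (λ j → x j * (M i k * N k j)))
    ≡⟨ sumFin-cong (λ k → sumFin-cong (λ j → rearrange (x j) (M i k) (N k j))) ⟩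
  sumFin (λ k → sumFin (λ j → M i k * (N k j * x j)))
    ≡⟨ sumFin-cong (λ k → *-distribˡ-sumFin (M i k) (λ j → N k j * x j)) ⟨
  sumFin (λ k → M i k * apply N x k)
    ∎
  where
  open ≡-Reasoning
  rearrange : ∀ a b c → a * (b * c) ≡ b * (c * a)
  rearrange = solve-∀

form-dot : ∀ {n} (G : Mat n) (x y : Vec n) → form G x y ≡ dot x (apply G y)
form-dot G x y = sumFin-cong λ i → trans
  (sumFin-cong (λ j → ℤ.*-assoc (x i) (G i j) (y j)))
  (sym (*-distribˡ-sumFin (x i) (λ j → G i j * y j)))

form-cong : ∀ {n} (G : Mat n) {x x′ y y′ : Vec n} → x ≗ x′ → y ≗ y′ → form G x y ≡ form G x′ y′
form-cong G x≗x′ y≗y′ =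
  sumFin-cong (λ i → sumFin-cong (λ j → cong₂ _*_ (cong (_* G i j) (x≗x′ i)) (y≗y′ j)))

form-linearˡ : ∀ {n} (G : Mat n) (x u w : Vec n) c →
  form G (λ i → x i + c * u i) w ≡ form G x w + c * form G u w
form-linearˡ G x u w c = begin
  form G (λ i → x i + c * u i) w            ≡⟨ form-dot G (λ i → x i + c * u i) w ⟩
  dot (λ i → x i + c * u i) (apply G w)     ≡⟨ dot-linearˡ x u (apply G w) c ⟩
  dot x (apply G w) + c * dot u (apply G w) ≡⟨ cong₂ (λ a b → a + c * b) (form-dot G x w) (form-dot G u w) ⟨
  form G x w + c * form G u w               ∎
  where open ≡-Reasoning

form-linearʳ : ∀ {n} (G : Mat n) (w x u : Vec n) c →
  form G w (λ i → x i + c * u i) ≡ form G w x + c * form G w u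
form-linearʳ G w x u c = begin
  form G w (λ i → x i + c * u i)            ≡⟨ form-dot G w (λ i → x i + c * u i) ⟩
  dot w (apply G (λ i → x i + c * u i))     ≡⟨ sumFin-cong (λ i → cong (w i *_) (dot-linearʳ (G i) x u c)) ⟩
  dot w (λ i → apply G x i + c * apply G u i) ≡⟨ dot-linearʳ w (apply G x) (apply G u) c ⟩
  dot w (apply G x) + c * dot w (apply G u) ≡⟨ cong₂ (λ a b → a + c * b) (form-dot G w x) (form-dot G w u) ⟨
  form G w x + c * form G w u               ∎
  where open ≡-Reasoning

form-zeroʳ : ∀ {n} (G : Mat n) (x : Vec n) → form G x (λ _ → + 0) ≡ + 0
form-zeroʳ G x = trans (form-dot G x (λ _ → + 0))
  (trans (sumFin-cong (λ i → cong (x i *_) (dot-zeroʳ (G i)))) (dot-zeroʳ x))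

Alternating : ∀ {n} → Mat n → Set
Alternating {n} G = (v : Vec n) → form G v v ≡ + 0

form-antisym : ∀ {n} {G : Mat n} → Alternating G → ∀ x y → form G x y ≡ - form G y x
form-antisym {G = G} alt x y = inverseˡ-unique (form G x y) (form G y x) (begin
  form G x y + form G y x
    ≡⟨ collect (form G x y) (form G y x) ⟩
  (+ 0 + + 1 * form G x y) + + 1 * (form G y x + + 1 * + 0)
    ≡⟨ cong₂ (λ a d → (a + + 1 * form G x y) + + 1 * (form G y x + + 1 * d)) (alt x) (alt y) ⟨
  (form G x x + + 1 * form G x y) + + 1 * (form G y x + + 1 * form G y y)
    ≡⟨ cong₂ (λ a b → a + + 1 * b) (form-linearʳ G x x y (+ 1)) (form-linearʳ G y x y (+ 1)) ⟨
  form G x x+y + + 1 * form G y x+y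
    ≡⟨ form-linearˡ G x y x+y (+ 1) ⟨
  form G x+y x+y
    ≡⟨ alt x+y ⟩
  + 0 ∎)
  where
  open ≡-Reasoning
  x+y : Vec _
  x+y i = x i + + 1 * y i
  collect : ∀ b c → b + c ≡ (+ 0 + + 1 * b) + + 1 * (c + + 1 * + 0)
  collect = solve-∀

mul-inverse : ∀ {n} (M M′ N N′ : Mat n) →
  (∀ v → apply M (apply M′ v) ≗ v) → (∀ v → apply N (apply N′ v) ≗ v) →
  ∀ v → apply (mul M N) (apply (mul N′ M′) v) ≗ v
mul-inverse M M′ N N′ MM′≗id NN′≗id v i = begin
  apply (mul M N) (apply (mul N′ M′) v) i  ≡⟨ apply-mul M N _ i ⟩
  apply M (apply N (apply (mul N′ M′) v)) i ≡⟨ apply-cong M NN′M′v≗M′v i ⟩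
  apply M (apply M′ v) i                    ≡⟨ MM′≗id v i ⟩
  v i                                       ∎
  where
  open ≡-Reasoning
  NN′M′v≗M′v : apply N (apply (mul N′ M′) v) ≗ apply M′ v
  NN′M′v≗M′v j = trans (apply-cong N (apply-mul N′ M′ v) j) (NN′≗id (apply M′ v) j)

InΓ-mul : ∀ {n} {G M N : Mat n} → InΓ G M → InΓ G N → InΓ G (mul M N)
InΓ-mul {G = G} {M} {N} (((M⁻¹ , MM⁻¹≗id , M⁻¹M≗id) , M-isometry) , M-disc)
                        (((N⁻¹ , NN⁻¹≗id , N⁻¹N≗id) , N-isometry) , N-disc) =
  ((mul N⁻¹ M⁻¹ , mul-inverse M M⁻¹ N N⁻¹ MM⁻¹≗id NN⁻¹≗id
                , mul-inverse N⁻¹ N M⁻¹ M N⁻¹N≗id M⁻¹M≗id)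
  , isometry) , disc
  where
  isometry : ∀ v w → form G (apply (mul M N) v) (apply (mul M N) w) ≡ form G v w
  isometry v w = trans (form-cong G (apply-mul M N v) (apply-mul M N w))
                       (trans (M-isometry (apply N v) (apply N w)) (N-isometry v w))

  form-adjoint : ∀ x w → form G (apply N x) w ≡ form G x (apply N⁻¹ w)
  form-adjoint x w = trans (form-cong G {apply N x} (λ _ → refl) (λ i → sym (NN⁻¹≗id w i)))
                           (N-isometry x (apply N⁻¹ w))

  disc : ActsTriviallyOnDisc G (mul M N)
  disc d d≢0 x d∣⟨x,-⟩ i = Signed.∣⇒∣ᵤ (subst (+ d Signed.∣_) (sym Δ)
    (Signed.∣m∣n⇒∣m+n (Signed.∣ᵤ⇒∣ {i = apply M Nx i - Nx i} d∣ΔM)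
                      (Signed.∣ᵤ⇒∣ {i = Nx i - x i} d∣ΔN)))
    where
    Nx : Vec _
    Nx = apply N x
    d∣ΔM : + d ∣ (apply M Nx i - Nx i)
    d∣ΔM = M-disc d d≢0 Nx (λ w → subst (+ d ∣_) (sym (form-adjoint x w)) (d∣⟨x,-⟩ (apply N⁻¹ w)))
                  i
    d∣ΔN : + d ∣ (Nx i - x i)
    d∣ΔN = N-disc d d≢0 x d∣⟨x,-⟩ i
    telescope : ∀ a b c → a - c ≡ (a - b) + (b - c)
    telescope = solve-∀
    Δ : apply (mul M N) x i - x i ≡ (apply M Nx i - Nx i) + (Nx i - x i)
    Δ = trans (cong (_- x i) (apply-mul M N x i)) (telescope (apply M Nx i) (Nx i) (x i))

transvection : ∀ {n} → Mat n → Vec n → ℤ → Mat n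
transvection G u k i j = δ i j + k * u i * apply G u j

module Transvection {n} {G : Mat n} (alt : Alternating G) (u : Vec n) where

  τ : ℤ → Mat n
  τ = transvection G u

  apply-τ : ∀ k x i → apply (τ k) x i ≡ x i + k * form G x u * u i
  apply-τ k x i = begin
    dot (λ j → δ i j + k * u i * apply G u j) x ≡⟨ dot-linearˡ (δ i) (apply G u) x (k * u i) ⟩
    dot (δ i) x + k * u i * dot (apply G u) x   ≡⟨ cong₂ (λ a b → a + k * u i * b) (sumFin-δ i x) ⟨x,u⟩ ⟩
    x i + k * u i * form G x u                  ≡⟨ cong (_+_ (x i)) (swap k (u i) (form G x u)) ⟩
    x i + k * form G x u * u i                  ∎
    where
    open ≡-Reasoning
    ⟨x,u⟩ : dot (apply G u) x ≡ form G x u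
    ⟨x,u⟩ = trans (dot-comm (apply G u) x) (sym (form-dot G x u))
    swap : ∀ a b c → a * b * c ≡ a * c * b
    swap = solve-∀

  form-τ-axis : ∀ k x → form G (apply (τ k) x) u ≡ form G x u
  form-τ-axis k x = begin
    form G (apply (τ k) x) u                    ≡⟨ form-cong G (apply-τ k x) (λ _ → refl) ⟩
    form G (λ i → x i + k * form G x u * u i) u ≡⟨ form-linearˡ G x u u (k * form G x u) ⟩
    form G x u + k * form G x u * form G u u    ≡⟨ cong (λ a → form G x u + k * form G x u * a) (alt u) ⟩
    form G x u + k * form G x u * + 0           ≡⟨ cong (_+_ (form G x u)) (ℤ.*-zeroʳ (k * form G x u)) ⟩
    form G x u + + 0                            ≡⟨ ℤ.+-identityʳ (form G x u) ⟩
    form G x u                                  ∎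
    where open ≡-Reasoning

  τ-cancel : ∀ k l → k + l ≡ + 0 → ∀ x → apply (τ l) (apply (τ k) x) ≗ x
  τ-cancel k l k+l≡0 x i = begin
    apply (τ l) y i
      ≡⟨ apply-τ l y i ⟩
    y i + l * form G y u * u i
      ≡⟨ cong₂ (λ a b → a + l * b * u i) (apply-τ k x i) (form-τ-axis k x) ⟩
    x i + k * form G x u * u i + l * form G x u * u i
      ≡⟨ combine (x i) k l (form G x u) (u i) ⟩
    x i + (k + l) * form G x u * u i
      ≡⟨ cong (λ c → x i + c * form G x u * u i) k+l≡0 ⟩
    x i + + 0
      ≡⟨ ℤ.+-identityʳ (x i) ⟩
    x i ∎
    where
    open ≡-Reasoning
    y : Vec n
    y = apply (τ k) x
    combine : ∀ a k l f b → a + k * f * b + l * f * b ≡ a + (k + l) * f * b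
    combine = solve-∀

  τ-isometry : ∀ k x y → form G (apply (τ k) x) (apply (τ k) y) ≡ form G x y
  τ-isometry k x y = begin
    form G (apply (τ k) x) (apply (τ k) y)
      ≡⟨ form-cong G (apply-τ k x) (apply-τ k y) ⟩
    form G (λ i → x i + a * u i) (λ i → y i + b * u i)
      ≡⟨ form-linearˡ G x u _ a ⟩
    form G x (λ i → y i + b * u i) + a * form G u (λ i → y i + b * u i)
      ≡⟨ cong₂ (λ p q → p + a * q) (form-linearʳ G x y u b) (form-linearʳ G u y u b) ⟩
    (form G x y + b * form G x u) + a * (form G u y + b * form G u u)
      ≡⟨ cong₂ (λ p q → (form G x y + b * form G x u) + a * (p + b * q)) (form-antisym alt u y) (alt u) ⟩
    (form G x y + b * form G x u) + a * (- form G y u + b * + 0)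
      ≡⟨ cancel (form G x y) k (form G x u) (form G y u) ⟩
    form G x y ∎
    where
    open ≡-Reasoning
    a b : ℤ
    a = k * form G x u
    b = k * form G y u
    cancel : ∀ f k p q → (f + k * q * p) + k * p * (- q + k * q * + 0) ≡ f
    cancel = solve-∀

  τ-disc : ∀ k → ActsTriviallyOnDisc G (τ k)
  τ-disc k d _ x d∣⟨x,-⟩ i = Signed.∣⇒∣ᵤ (subst (+ d Signed.∣_) (sym Δ)
    (Signed.∣m⇒∣m*n (u i) (Signed.∣n⇒∣m*n k (Signed.∣ᵤ⇒∣ {i = form G x u} (d∣⟨x,-⟩ u)))))
    where
    cancelˡ : ∀ a c → a + c - a ≡ c
    cancelˡ = solve-∀
    Δ : apply (τ k) x i - x i ≡ k * form G x u * u i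
    Δ = trans (cong (_- x i) (apply-τ k x i)) (cancelˡ (x i) (k * form G x u * u i))

  τ∈Γ : ∀ k → InΓ G (τ k)
  τ∈Γ k = ((τ (- k) , τ-cancel (- k) k (ℤ.+-inverseˡ k) , τ-cancel k (- k) (ℤ.+-inverseʳ k))
          , τ-isometry k) , τ-disc k

module Reachability {n} (G : Mat n) where

  infix 4 _↝_
  _↝_ : Vec n → Vec n → Set
  x ↝ y = Σ (Mat n) λ γ → InΓ G γ × apply γ x ≗ y

  ↝-trans : ∀ {x y z} → x ↝ y → y ↝ z → x ↝ z
  ↝-trans {x} (γ , γ∈Γ , γx≗y) (γ′ , γ′∈Γ , γ′y≗z) =
    mul γ′ γ , InΓ-mul {M = γ′} {N = γ} γ′∈Γ γ∈Γ ,
    λ i → trans (apply-mul γ′ γ x i) (trans (apply-cong γ′ γx≗y i) (γ′y≗z i))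

  ↝-transvection : Alternating G → ∀ u k x → x ↝ (λ i → x i + k * form G x u * u i)
  ↝-transvection alt u k x = τ k , τ∈Γ k , apply-τ k x
    where open Transvection alt u

a-[a/b]*b≡a%b : ∀ a b .{{_ : NonZero b}} → a + - (a / b) * b ≡ + (a % b)
a-[a/b]*b≡a%b a b = trans (cong (λ x → x + - (a / b) * b) (a≡a%n+[a/n]*n a b))
                          (cancel (+ (a % b)) (a / b) b)
  where
  cancel : ∀ r q d → r + q * d + - q * d ≡ r
  cancel = solve-∀

module Euclid {S : Set} (_↝_ : S → S → Set) (↝-trans : Transitive _↝_) (a b : S → ℤ)
  (shiftˡ : ∀ s k → Σ S λ t → s ↝ t × a t ≡ a s + k * b s × b t ≡ b s)
  (shiftʳ : ∀ s k → Σ S λ t → s ↝ t × a t ≡ a s × b t ≡ b s + k * a s)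
  where

  rotate : ∀ s → Σ S λ t → s ↝ t × a t ≡ b s × b t ≡ - a s
  rotate s =
    let t₁ , s↝t₁ , a₁ , b₁ = shiftˡ s (+ 1)
        t₂ , t₁↝t₂ , a₂ , b₂ = shiftʳ t₁ (- + 1)
        t₃ , t₂↝t₃ , a₃ , b₃ = shiftˡ t₂ (+ 1)
    in t₃ , ↝-trans s↝t₁ (↝-trans t₁↝t₂ t₂↝t₃)
       , trans a₃ (trans (cong₂ (λ x y → x + + 1 * y) a₂ b₂) (trans (rotateᵃ (a t₁) (b t₁)) b₁))
       , trans b₃ (trans b₂ (trans (cong₂ (λ y x → y + - + 1 * x) b₁ a₁) (rotateᵇ (a s) (b s))))
    where
    rotateᵃ : ∀ x y → x + + 1 * (y + - + 1 * x) ≡ y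
    rotateᵃ = solve-∀
    rotateᵇ : ∀ x y → y + - + 1 * (x + + 1 * y) ≡ - x
    rotateᵇ = solve-∀

  -- a is replaced by a mod b and the pair is then rotated, so the new b is −(a mod b).
  euclid-step : ∀ s → b s ≢ + 0 → Σ S λ t → s ↝ t × ∣ b t ∣ ℕ.< ∣ b s ∣
  euclid-step s b≢0 =
    let t₁ , s↝t₁ , a₁ , _ = shiftˡ s (- (a s / b s))
        t₂ , t₁↝t₂ , _ , b₂ = rotate t₁
        ∣bt₂∣≡a%b = trans (cong ∣_∣ (trans b₂ (cong -_ (trans a₁ (a-[a/b]*b≡a%b (a s) (b s))))))
                          (ℤ.∣-i∣≡∣i∣ (+ (a s % b s)))
    in t₂ , ↝-trans s↝t₁ t₁↝t₂ , subst (ℕ._< ∣ b s ∣) (sym ∣bt₂∣≡a%b) (n%d<d (a s) (b s))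
    where
    instance
      b-nonZero : NonZero (b s)
      b-nonZero = ≢-nonZero b≢0

  reach-a≡0 : ∀ s → Σ S λ t → s ↝ t × a t ≡ + 0
  reach-a≡0 s = descend s (<-wellFounded ∣ b s ∣)
    where
    descend : ∀ s → Acc ℕ._<_ ∣ b s ∣ → Σ S λ t → s ↝ t × a t ≡ + 0
    descend s (acc rec) with b s ℤ.≟ + 0
    ... | yes b≡0 = let t , s↝t , aₜ , _ = rotate s in t , s↝t , trans aₜ b≡0
    ... | no b≢0 =
      let t , s↝t , ∣bₜ∣<∣bₛ∣ = euclid-step s b≢0
          u , t↝u , aᵤ = descend t (rec ∣bₜ∣<∣bₛ∣)
      in u , ↝-trans s↝t t↝u , aᵤ

ω : Vec 4 → Vec 4 → ℤ
ω p q = (p (# 0) * q (# 1) - p (# 1) * q (# 0)) + (p (# 2) * q (# 3) - p (# 3) * q (# 2))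

ω-congˡ : ∀ {p p′} → p ≗ p′ → ∀ q → ω p q ≡ ω p′ q
ω-congˡ p≗p′ q = cong₂ _+_
  (cong₂ _-_ (cong (_* q (# 1)) (p≗p′ (# 0))) (cong (_* q (# 0)) (p≗p′ (# 1))))
  (cong₂ _-_ (cong (_* q (# 3)) (p≗p′ (# 2))) (cong (_* q (# 2)) (p≗p′ (# 3))))

module HyperbolicPlanes {m} (B : Mat m) where

  G : Mat (4 ℕ.+ m)
  G = blockGram B

  embed : Vec 4 → Vec (4 ℕ.+ m)
  embed u = u ++ replicate m (+ 0)

  embed-↑ˡ : ∀ u j → embed u (j ↑ˡ m) ≡ u j
  embed-↑ˡ u j = cong [ u , replicate m (+ 0) ] (splitAt-↑ˡ 4 j m)

  private
    top-row : ∀ i y → (∀ (k : Fin m) → G i (4 ↑ʳ k) ≡ + 0) →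
      apply G y i ≡ G i (# 0) * y (# 0) + (G i (# 1) * y (# 1)
                      + (G i (# 2) * y (# 2) + (G i (# 3) * y (# 3) + + 0)))
    top-row i y G≡0 =
      cong (λ t → G i (# 0) * y (# 0) + (G i (# 1) * y (# 1)
                    + (G i (# 2) * y (# 2) + (G i (# 3) * y (# 3) + t))))
           (sumFin-zero {f = λ k → G i (4 ↑ʳ k) * y (4 ↑ʳ k)}
                        (λ k → cong (λ g → g * y (4 ↑ʳ k)) (G≡0 k)))

    row₀ : ∀ y → apply G y (# 0) ≡ y (# 1)
    row₀ y = trans (top-row (# 0) y (λ _ → refl)) (simplify (y (# 0)) (y (# 1)) (y (# 2)) (y (# 3)))
      where
      simplify : ∀ a b c d → + 0 * a + (+ 1 * b + (+ 0 * c + (+ 0 * d + + 0))) ≡ b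
      simplify = solve-∀

    row₁ : ∀ y → apply G y (# 1) ≡ - y (# 0)
    row₁ y = trans (top-row (# 1) y (λ _ → refl)) (simplify (y (# 0)) (y (# 1)) (y (# 2)) (y (# 3)))
      where
      simplify : ∀ a b c d → - + 1 * a + (+ 0 * b + (+ 0 * c + (+ 0 * d + + 0))) ≡ - a
      simplify = solve-∀

    row₂ : ∀ y → apply G y (# 2) ≡ y (# 3)
    row₂ y = trans (top-row (# 2) y (λ _ → refl)) (simplify (y (# 0)) (y (# 1)) (y (# 2)) (y (# 3)))
      where
      simplify : ∀ a b c d → + 0 * a + (+ 0 * b + (+ 0 * c + (+ 1 * d + + 0))) ≡ d
      simplify = solve-∀

    row₃ : ∀ y → apply G y (# 3) ≡ - y (# 2)
    row₃ y = trans (top-row (# 3) y (λ _ → refl)) (simplify (y (# 0)) (y (# 1)) (y (# 2)) (y (# 3)))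
      where
      simplify : ∀ a b c d → + 0 * a + (+ 0 * b + (- + 1 * c + (+ 0 * d + + 0))) ≡ - c
      simplify = solve-∀

    row-↑ʳ : ∀ y k → apply G y (4 ↑ʳ k) ≡ apply B (drop 4 y) k
    row-↑ʳ y k = simplify (apply B (drop 4 y) k)
      where
      simplify : ∀ t → + 0 + (+ 0 + (+ 0 + (+ 0 + t))) ≡ t
      simplify = solve-∀

  form-blockGram : ∀ x y → form G x y ≡ ω (take 4 x) (take 4 y) + form B (drop 4 x) (drop 4 y)
  form-blockGram x y = begin
    form G x y
      ≡⟨ form-dot G x y ⟩
    dot x (apply G y)
      ≡⟨ cong₂ _+_ (cong (x (# 0) *_) (row₀ y)) (cong₂ _+_ (cong (x (# 1) *_) (row₁ y))
           (cong₂ _+_ (cong (x (# 2) *_) (row₂ y)) (cong₂ _+_ (cong (x (# 3) *_) (row₃ y))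
             (sumFin-cong (λ k → cong (x (4 ↑ʳ k) *_) (row-↑ʳ y k)))))) ⟩
    x (# 0) * y (# 1) + (x (# 1) * - y (# 0) + (x (# 2) * y (# 3) + (x (# 3) * - y (# 2)
      + dot (drop 4 x) (apply B (drop 4 y)))))
      ≡⟨ regroup (x (# 0)) (x (# 1)) (x (# 2)) (x (# 3)) (y (# 0)) (y (# 1)) (y (# 2)) (y (# 3)) _ ⟩
    ω (take 4 x) (take 4 y) + dot (drop 4 x) (apply B (drop 4 y))
      ≡⟨ cong (_+_ (ω (take 4 x) (take 4 y))) (form-dot B (drop 4 x) (drop 4 y)) ⟨
    ω (take 4 x) (take 4 y) + form B (drop 4 x) (drop 4 y)
      ∎
    where
    open ≡-Reasoning
    regroup : ∀ x₀ x₁ x₂ x₃ y₀ y₁ y₂ y₃ t →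
      x₀ * y₁ + (x₁ * - y₀ + (x₂ * y₃ + (x₃ * - y₂ + t)))
        ≡ (x₀ * y₁ - x₁ * y₀ + (x₂ * y₃ - x₃ * y₂)) + t
    regroup = solve-∀

  blockGram-alternating : Alternating B → Alternating G
  blockGram-alternating alt v = trans (form-blockGram v v)
    (cong₂ _+_ (ω-self (v (# 0)) (v (# 1)) (v (# 2)) (v (# 3))) (alt (drop 4 v)))
    where
    ω-self : ∀ a b c d → a * b - b * a + (c * d - d * c) ≡ + 0
    ω-self = solve-∀

  form-embed : ∀ x u → form G x (embed u) ≡ ω (take 4 x) u
  form-embed x u = trans (form-blockGram x (embed u))
    (trans (cong (_+_ (ω (take 4 x) u)) (form-zeroʳ B (drop 4 x))) (ℤ.+-identityʳ _))

module HyperbolicReduction {m} {B : Mat m} (alt : Alternating B) where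

  open HyperbolicPlanes B
  open Reachability G

  -- Only the coordinates along U₁ ⊕ U₂ matter, so reachability is tracked on those alone.
  infix 4 _⇝_
  _⇝_ : Vec 4 → Vec 4 → Set
  p ⇝ q = ∀ x → take 4 x ≗ p → Σ (Vec (4 ℕ.+ m)) λ y → x ↝ y × take 4 y ≗ q

  ⇝-trans : Transitive _⇝_
  ⇝-trans p⇝q q⇝r x x≈p =
    let y , x↝y , y≈q = p⇝q x x≈p
        z , y↝z , z≈r = q⇝r y y≈q
    in z , ↝-trans {x} {y} {z} x↝y y↝z , z≈r

  ⇝-realise : ∀ {p q} → p ⇝ q → ∀ x → take 4 x ≗ p →
    Σ (Mat (4 ℕ.+ m)) λ γ → InΓ G γ × take 4 (apply γ x) ≗ q
  ⇝-realise p⇝q x x≈p with p⇝q x x≈p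
  ... | y , (γ , γ∈Γ , γx≗y) , y≈q = γ , γ∈Γ , λ j → trans (γx≗y (j ↑ˡ m)) (y≈q j)

  ⇝-transvection : ∀ u k p {a b c d} →
    p (# 0) + k * ω p u * u (# 0) ≡ a → p (# 1) + k * ω p u * u (# 1) ≡ b →
    p (# 2) + k * ω p u * u (# 2) ≡ c → p (# 3) + k * ω p u * u (# 3) ≡ d →
    p ⇝ (a ∷ b ∷ c ∷ d ∷ [])
  ⇝-transvection u k p {a} {b} {c} {d} eq₀ eq₁ eq₂ eq₃ x x≈p =
    y , ↝-transvection (blockGram-alternating alt) (embed u) k x , y≈q
    where
    open ≡-Reasoning
    y : Vec (4 ℕ.+ m)
    y i = x i + k * form G x (embed u) * embed u i
    shifted : ∀ j → take 4 y j ≡ p j + k * ω p u * u j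
    shifted j = begin
      x (j ↑ˡ m) + k * form G x (embed u) * embed u (j ↑ˡ m)
        ≡⟨ cong₂ (λ z e → z + k * form G x (embed u) * e) (x≈p j) (embed-↑ˡ u j) ⟩
      p j + k * form G x (embed u) * u j
        ≡⟨ cong (λ f → p j + k * f * u j) (trans (form-embed x u) (ω-congˡ x≈p u)) ⟩
      p j + k * ω p u * u j
        ∎
    y≈q : take 4 y ≗ (a ∷ b ∷ c ∷ d ∷ [])
    y≈q zero                   = trans (shifted zero) eq₀
    y≈q (suc zero)             = trans (shifted (suc zero)) eq₁
    y≈q (suc (suc zero))       = trans (shifted (suc (suc zero))) eq₂
    y≈q (suc (suc (suc zero))) = trans (shifted (suc (suc (suc zero)))) eq₃

  private
    a+c*0≡a : ∀ a c → a + c * + 0 ≡ a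
    a+c*0≡a a c = trans (cong (_+_ a) (ℤ.*-zeroʳ c)) (ℤ.+-identityʳ a)

    k*c-k*c≡0 : ∀ k c → k * c + - k * c ≡ + 0
    k*c-k*c≡0 = solve-∀

  e₁ f₁ e₂ f₂ e₁+e₂ f₁+f₂ : Vec 4
  e₁    = + 1 ∷ + 0 ∷ + 0 ∷ + 0 ∷ []
  f₁    = + 0 ∷ + 1 ∷ + 0 ∷ + 0 ∷ []
  e₂    = + 0 ∷ + 0 ∷ + 1 ∷ + 0 ∷ []
  f₂    = + 0 ∷ + 0 ∷ + 0 ∷ + 1 ∷ []
  e₁+e₂ = + 1 ∷ + 0 ∷ + 1 ∷ + 0 ∷ []
  f₁+f₂ = + 0 ∷ + 1 ∷ + 0 ∷ + 1 ∷ []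

  ⇝-τ[e₁] : ∀ k p → p ⇝ (p (# 0) + k * p (# 1) ∷ p (# 1) ∷ p (# 2) ∷ p (# 3) ∷ [])
  ⇝-τ[e₁] k p = ⇝-transvection e₁ (- k) p
    (shift (p (# 0)) (p (# 1)) (p (# 2)) (p (# 3)) k)
    (a+c*0≡a (p (# 1)) c) (a+c*0≡a (p (# 2)) c) (a+c*0≡a (p (# 3)) c)
    where
    c : ℤ
    c = - k * ω p e₁
    shift : ∀ a b c d k → a + - k * (a * + 0 - b * + 1 + (c * + 0 - d * + 0)) * + 1 ≡ a + k * b
    shift = solve-∀

  ⇝-τ[f₁] : ∀ k p → p ⇝ (p (# 0) ∷ p (# 1) + k * p (# 0) ∷ p (# 2) ∷ p (# 3) ∷ [])
  ⇝-τ[f₁] k p = ⇝-transvection f₁ k p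
    (a+c*0≡a (p (# 0)) c)
    (shift (p (# 0)) (p (# 1)) (p (# 2)) (p (# 3)) k)
    (a+c*0≡a (p (# 2)) c) (a+c*0≡a (p (# 3)) c)
    where
    c : ℤ
    c = k * ω p f₁
    shift : ∀ a b c d k → b + k * (a * + 1 - b * + 0 + (c * + 0 - d * + 0)) * + 1 ≡ b + k * a
    shift = solve-∀

  ⇝-τ[e₂] : ∀ k p → p ⇝ (p (# 0) ∷ p (# 1) ∷ p (# 2) + k * p (# 3) ∷ p (# 3) ∷ [])
  ⇝-τ[e₂] k p = ⇝-transvection e₂ (- k) p
    (a+c*0≡a (p (# 0)) c) (a+c*0≡a (p (# 1)) c)
    (shift (p (# 0)) (p (# 1)) (p (# 2)) (p (# 3)) k)
    (a+c*0≡a (p (# 3)) c)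
    where
    c : ℤ
    c = - k * ω p e₂
    shift : ∀ a b c d k → c + - k * (a * + 0 - b * + 0 + (c * + 0 - d * + 1)) * + 1 ≡ c + k * d
    shift = solve-∀

  ⇝-τ[f₂] : ∀ k p → p ⇝ (p (# 0) ∷ p (# 1) ∷ p (# 2) ∷ p (# 3) + k * p (# 2) ∷ [])
  ⇝-τ[f₂] k p = ⇝-transvection f₂ k p
    (a+c*0≡a (p (# 0)) c) (a+c*0≡a (p (# 1)) c) (a+c*0≡a (p (# 2)) c)
    (shift (p (# 0)) (p (# 1)) (p (# 2)) (p (# 3)) k)
    where
    c : ℤ
    c = k * ω p f₂
    shift : ∀ a b c d k → d + k * (a * + 0 - b * + 0 + (c * + 1 - d * + 0)) * + 1 ≡ d + k * c
    shift = solve-∀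

  -- τ[f₁+f₂] also shifts the f₂-coordinate, by k c; τ[f₂] with coefficient −k undoes that.
  ⇝-τ[f₁+f₂]τ[f₂] : ∀ k b c → (+ 0 ∷ b ∷ c ∷ + 0 ∷ []) ⇝ (+ 0 ∷ b + k * c ∷ c ∷ + 0 ∷ [])
  ⇝-τ[f₁+f₂]τ[f₂] k b c = ⇝-trans
    (⇝-transvection f₁+f₂ k p
      (a+c*0≡a (+ 0) k⟨p,u⟩) (shift₁ b c k) (a+c*0≡a c k⟨p,u⟩) (shift₃ b c k))
    (subst (λ z → q ⇝ (+ 0 ∷ b + k * c ∷ c ∷ z ∷ [])) (k*c-k*c≡0 k c) (⇝-τ[f₂] (- k) q))
    where
    p q : Vec 4
    p = + 0 ∷ b ∷ c ∷ + 0 ∷ []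
    q = + 0 ∷ b + k * c ∷ c ∷ k * c ∷ []
    k⟨p,u⟩ : ℤ
    k⟨p,u⟩ = k * ω p f₁+f₂
    shift₁ : ∀ b c k → b + k * (+ 0 * + 1 - b * + 0 + (c * + 1 - + 0 * + 0)) * + 1 ≡ b + k * c
    shift₁ = solve-∀
    shift₃ : ∀ b c k → + 0 + k * (+ 0 * + 1 - b * + 0 + (c * + 1 - + 0 * + 0)) * + 1 ≡ k * c
    shift₃ = solve-∀

  ⇝-τ[e₁+e₂]τ[e₁] : ∀ k b c → (+ 0 ∷ b ∷ c ∷ + 0 ∷ []) ⇝ (+ 0 ∷ b ∷ c + k * b ∷ + 0 ∷ [])
  ⇝-τ[e₁+e₂]τ[e₁] k b c = ⇝-trans
    (⇝-transvection e₁+e₂ (- k) p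
      (shift₀ b c k) (a+c*0≡a b k⟨p,u⟩) (shift₂ b c k) (a+c*0≡a (+ 0) k⟨p,u⟩))
    (subst (λ z → q ⇝ (z ∷ b ∷ c + k * b ∷ + 0 ∷ [])) (k*c-k*c≡0 k b) (⇝-τ[e₁] (- k) q))
    where
    p q : Vec 4
    p = + 0 ∷ b ∷ c ∷ + 0 ∷ []
    q = k * b ∷ b ∷ c + k * b ∷ + 0 ∷ []
    k⟨p,u⟩ : ℤ
    k⟨p,u⟩ = - k * ω p e₁+e₂
    shift₀ : ∀ b c k → + 0 + - k * (+ 0 * + 0 - b * + 1 + (c * + 0 - + 0 * + 1)) * + 1 ≡ k * b
    shift₀ = solve-∀
    shift₂ : ∀ b c k → c + - k * (+ 0 * + 0 - b * + 1 + (c * + 0 - + 0 * + 1)) * + 1 ≡ c + k * b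
    shift₂ = solve-∀

  clear-e₁ : ∀ a b c d →
    Σ (ℤ × ℤ × ℤ) λ (b′ , c′ , d′) → (a ∷ b ∷ c ∷ d ∷ []) ⇝ (+ 0 ∷ b′ ∷ c′ ∷ d′ ∷ [])
  clear-e₁ a b c d =
    let (a′ , b′ , c′ , d′) , p⇝q , a′≡0 = reach-a≡0 (a , b , c , d)
    in (b′ , c′ , d′) , subst (λ z → vec (a , b , c , d) ⇝ vec (z , b′ , c′ , d′)) a′≡0 p⇝q
    where
    S : Set
    S = ℤ × ℤ × ℤ × ℤ
    vec : S → Vec 4
    vec (a , b , c , d) = a ∷ b ∷ c ∷ d ∷ []
    α β : S → ℤ
    α = proj₁
    β = proj₁ ∘ proj₂
    shiftˡ : ∀ s k → Σ S λ t → vec s ⇝ vec t × α t ≡ α s + k * β s × β t ≡ β s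
    shiftˡ (a , b , c , d) k = (a + k * b , b , c , d) , ⇝-τ[e₁] k (vec (a , b , c , d)) , refl , refl
    shiftʳ : ∀ s k → Σ S λ t → vec s ⇝ vec t × α t ≡ α s × β t ≡ β s + k * α s
    shiftʳ (a , b , c , d) k = (a , b + k * a , c , d) , ⇝-τ[f₁] k (vec (a , b , c , d)) , refl , refl
    open Euclid (_⇝_ on vec) ⇝-trans α β shiftˡ shiftʳ

  clear-f₂ : ∀ b c d →
    Σ (ℤ × ℤ) λ (b′ , c′) → (+ 0 ∷ b ∷ c ∷ d ∷ []) ⇝ (+ 0 ∷ b′ ∷ c′ ∷ + 0 ∷ [])
  clear-f₂ b c d =
    let (b′ , c′ , d′) , p⇝q , d′≡0 = reach-a≡0 (b , c , d)
    in (b′ , c′) , subst (λ z → vec (b , c , d) ⇝ vec (b′ , c′ , z)) d′≡0 p⇝q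
    where
    S : Set
    S = ℤ × ℤ × ℤ
    vec : S → Vec 4
    vec (b , c , d) = + 0 ∷ b ∷ c ∷ d ∷ []
    α β : S → ℤ
    α = proj₂ ∘ proj₂
    β = proj₁ ∘ proj₂
    shiftˡ : ∀ s k → Σ S λ t → vec s ⇝ vec t × α t ≡ α s + k * β s × β t ≡ β s
    shiftˡ (b , c , d) k = (b , c , d + k * c) , ⇝-τ[f₂] k (vec (b , c , d)) , refl , refl
    shiftʳ : ∀ s k → Σ S λ t → vec s ⇝ vec t × α t ≡ α s × β t ≡ β s + k * α s
    shiftʳ (b , c , d) k = (b , c + k * d , d) , ⇝-τ[e₂] k (vec (b , c , d)) , refl , refl
    open Euclid (_⇝_ on vec) ⇝-trans α β shiftˡ shiftʳ

  clear-f₁ : ∀ b c → Σ ℤ λ c′ → (+ 0 ∷ b ∷ c ∷ + 0 ∷ []) ⇝ (+ 0 ∷ + 0 ∷ c′ ∷ + 0 ∷ [])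
  clear-f₁ b c =
    let (b′ , c′) , p⇝q , b′≡0 = reach-a≡0 (b , c)
    in c′ , subst (λ z → vec (b , c) ⇝ vec (z , c′)) b′≡0 p⇝q
    where
    S : Set
    S = ℤ × ℤ
    vec : S → Vec 4
    vec (b , c) = + 0 ∷ b ∷ c ∷ + 0 ∷ []
    α β : S → ℤ
    α = proj₁
    β = proj₂
    shiftˡ : ∀ s k → Σ S λ t → vec s ⇝ vec t × α t ≡ α s + k * β s × β t ≡ β s
    shiftˡ (b , c) k = (b + k * c , c) , ⇝-τ[f₁+f₂]τ[f₂] k b c , refl , refl
    shiftʳ : ∀ s k → Σ S λ t → vec s ⇝ vec t × α t ≡ α s × β t ≡ β s + k * α s
    shiftʳ (b , c) k = (b , c + k * b) , ⇝-τ[e₁+e₂]τ[e₁] k b c , refl , refl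
    open Euclid (_⇝_ on vec) ⇝-trans α β shiftˡ shiftʳ

  clear-U₁ : ∀ a b c d → Σ ℤ λ c′ → (a ∷ b ∷ c ∷ d ∷ []) ⇝ (+ 0 ∷ + 0 ∷ c′ ∷ + 0 ∷ [])
  clear-U₁ a b c d =
    let (b₁ , c₁ , d₁) , ⇝₁ = clear-e₁ a b c d
        (b₂ , c₂) , ⇝₂ = clear-f₂ b₁ c₁ d₁
        c₃ , ⇝₃ = clear-f₁ b₂ c₂
    in c₃ , ⇝-trans ⇝₁ (⇝-trans ⇝₂ ⇝₃)

lemma2p5 : (m : ℕ) (B'' : Mat m) → IsSymplectic B'' →
    (v : Vec (4 ℕ.+ m)) →
    Σ (Mat (4 ℕ.+ m)) (λ γ → InΓ (blockGram B'') γ ×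
      (apply γ v zero ≡ + 0 × apply γ v (suc zero) ≡ + 0))
lemma2p5 m B'' (alternating , _) v =
  conclude (⇝-realise (proj₂ (clear-U₁ (v (# 0)) (v (# 1)) (v (# 2)) (v (# 3)))) v top-v)
  where
  open HyperbolicReduction alternating
  top-v : take 4 v ≗ (v (# 0) ∷ v (# 1) ∷ v (# 2) ∷ v (# 3) ∷ [])
  top-v zero                   = refl
  top-v (suc zero)             = refl
  top-v (suc (suc zero))       = refl
  top-v (suc (suc (suc zero))) = refl
  -- Taking γ as an argument keeps it a variable: reading the coordinates off the witness
  -- directly would make Agda normalise the Euclidean algorithm.
  conclude : ∀ {c} →
    Σ (Mat (4 ℕ.+ m)) (λ γ → InΓ (blockGram B'') γ ×
      take 4 (apply γ v) ≗ (+ 0 ∷ + 0 ∷ c ∷ + 0 ∷ [])) →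
    Σ (Mat (4 ℕ.+ m)) (λ γ → InΓ (blockGram B'') γ ×
      (apply γ v zero ≡ + 0 × apply γ v (suc zero) ≡ + 0))
  conclude (γ , γ∈Γ , γv≈) = γ , γ∈Γ , γv≈ (# 0) , γv≈ (# 1)
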